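{- A $14$-tuple $(a,b,c,d,e,f,g,h,i,j,k,l,m,n)$ equals $$(y_{1,0},y_{2,0},y_{3,0},y_{4,0},\;y_{1,1},y_{2,1},y_{3,1},y_{4,1},\;y_{1,2},y_{2,2},y_{3,2},\;y_{1,3},y_{2,3},\;y_{1,4})$$ for some arithmetic Y-frieze pattern $(y_{i,j})$ of width $4$ if and only if it is one of the following $42$ tuples: (1,1,2,3,2,9,20,7,5,14,6,3,2,1), (1,1,4,5,2,15,24,5,8,15,4,2,1,1), (1,2,3,2,3,8,9,5,3,5,4,2,3,2), (1,2,3,4,3,8,15,4,3,8,3,3,2,1), (1,2,6,7,3,14,20,3,5,9,2,2,1,1), (1,2,9,5,3,20,14,3,7,6,2,1,1,2), (1,3,8,3,4,15,8,3,4,3,2,1,2,3), (1,4,5,3,5,9,8,3,2,3,2,2,3,2), (1,4,15,8,5,24,15,2,5,4,1,1,1,2), (1,6,14,5,7,20,9,2,3,2,1,1,2,3), (2,1,1,2,1,4,15,8,5,24,15,5,4,1), (2,1,2,3,1,6,14,5,7,20,9,3,2,1), (2,3,2,1,2,3,4,5,2,5,9,3,8,3), (2,3,2,3,2,3,8,3,2,9,5,5,4,1), (2,3,4,5,2,5,9,2,3,8,3,3,2,1), (2,3,8,3,2,9,5,2,5,4,3,1,2,3), (2,5,9,2,3,8,3,2,3,2,3,1,4,5), (2,9,5,2,5,4,3,2,1,2,3,3,8,3), (2,9,20,7,5,14,6,1,3,2,1,1,2,3), (2,15,24,5,8,15,4,1,2,1,1,1,4,5), (3,2,1,1,1,2,6,7,3,14,20,5,9,2),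 (3,2,1,2,1,2,9,5,3,20,14,7,6,1), (3,2,2,3,1,3,8,3,4,15,8,4,3,1), (3,2,3,2,1,4,5,3,5,9,8,2,3,2), (3,5,4,1,2,3,2,3,2,3,8,2,9,5), (3,8,3,1,3,2,2,3,1,3,8,4,15,4), (3,8,3,2,3,2,3,2,1,4,5,5,9,2), (3,8,9,5,3,5,4,1,2,3,2,2,3,2), (3,8,15,4,3,8,3,1,3,2,2,1,3,4), (3,14,20,3,5,9,2,1,2,1,2,1,6,7), (3,20,14,3,7,6,2,1,1,1,2,2,9,5), (4,3,2,1,1,2,3,4,3,8,15,3,8,3), (4,15,8,3,4,3,2,1,1,2,3,3,8,3), (5,4,1,1,1,1,4,5,2,15,24,8,15,2), (5,4,3,2,1,2,3,2,3,8,9,3,5,2), (5,9,2,1,2,1,2,3,1,6,14,7,20,3), (5,9,8,3,2,3,2,1,2,3,4,2,5,3), (5,14,6,1,3,2,1,2,1,2,9,3,20,7), (5,24,15,2,5,4,1,1,1,1,4,2,15,8), (7,6,2,1,1,1,2,3,2,9,20,5,14,3), (7,20,9,2,3,2,1,1,1,2,6,3,14,5), (8,15,4,1,2,1,1,2,1,4,15,5,24,5).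
   Context: A Y-frieze pattern of width $n$ is an array of rational numbers $y_{i,j}$, $i=0,1,\dots,n+1$, $j\in\mathbb{Z}$, arranged in staggered rows (entry $y_{i,j}$ placed at horizontal position $j+i/2$ in row $i$), such that row $0$ and row $n+1$ consist entirely of $0$'s, no row strictly between them consists entirely of $0$'s, and the Y-diamond rule $WE=(1+N)(1+S)$ holds for every diamond, i.e. $y_{i,j}\,y_{i,j+1}=(1+y_{i-1,j+1})(1+y_{i+1,j})$ for $1\le i\le n$, $j\in\mathbb{Z}$. It is arithmetic if all entries in rows $1,\dots,n$ (its non-zero entries) are positive integers. For width $4$, the listed $14$ entries form a fundamental domain of the glide symmetry of the pattern. -}

module Defs where

open import Data.Nat as ℕ using (ℕ; suc; _≤_)
open import Data.Integer as ℤ using (ℤ; +_)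
open import Data.Rational using (ℚ; 0ℚ; 1ℚ; _+_; _*_; _/_)
open import Data.Product using (Σ; _×_)
open import Data.Vec using (Vec; []; _∷_)
open import Data.List using (List; []; _∷_)
open import Relation.Binary.PropositionalEquality using (_≡_)
open import Relation.Nullary using (¬_)

ℕtoℚ : ℕ → ℚ
ℕtoℚ k = + k / 1

-- Entries y i j for rows i = 0,…,n+1 and
-- columns j ∈ ℤ (entry y i j sits at horizontal position j + i/2).
-- Values of y at rows i > n+1 are irrelevant (never constrained, never used).
record YFrieze (n : ℕ) : Set where
  field
    y        : ℕ → ℤ → ℚ
    row0     : ∀ j → y 0 j ≡ 0ℚ
    rowLast  : ∀ j → y (suc n) j ≡ 0ℚ
    nonzero  : ∀ i → 1 ≤ i → i ≤ n → ¬ (∀ j → y i j ≡ 0ℚ)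
    diamond  : ∀ i j → (1≤i : 1 ≤ i) → i ≤ n →
               y i j * y i (j ℤ.+ ℤ.1ℤ)
                 ≡ (1ℚ + y (ℕ.pred i) (j ℤ.+ ℤ.1ℤ)) * (1ℚ + y (suc i) j)

open YFrieze public

Arithmetic : ∀ {n} → YFrieze n → Set
Arithmetic {n} F = ∀ i j → 1 ≤ i → i ≤ n →
  Σ ℕ (λ k → (1 ≤ k) × (y F i j ≡ ℕtoℚ k))

tuple14 : YFrieze 4 → Vec ℚ 14
tuple14 F =
  Y 1 0 ∷ Y 2 0 ∷ Y 3 0 ∷ Y 4 0 ∷
  Y 1 1 ∷ Y 2 1 ∷ Y 3 1 ∷ Y 4 1 ∷
  Y 1 2 ∷ Y 2 2 ∷ Y 3 2 ∷
  Y 1 3 ∷ Y 2 3 ∷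
  Y 1 4 ∷ []
  where
  Y : ℕ → ℕ → ℚ
  Y i j = y F i (+ j)

list42 : List (Vec ℕ 14)
list42 =
  (1 ∷ 1 ∷ 2 ∷ 3 ∷ 2 ∷ 9 ∷ 20 ∷ 7 ∷ 5 ∷ 14 ∷ 6 ∷ 3 ∷ 2 ∷ 1 ∷ []) ∷
  (1 ∷ 1 ∷ 4 ∷ 5 ∷ 2 ∷ 15 ∷ 24 ∷ 5 ∷ 8 ∷ 15 ∷ 4 ∷ 2 ∷ 1 ∷ 1 ∷ []) ∷
  (1 ∷ 2 ∷ 3 ∷ 2 ∷ 3 ∷ 8 ∷ 9 ∷ 5 ∷ 3 ∷ 5 ∷ 4 ∷ 2 ∷ 3 ∷ 2 ∷ []) ∷
  (1 ∷ 2 ∷ 3 ∷ 4 ∷ 3 ∷ 8 ∷ 15 ∷ 4 ∷ 3 ∷ 8 ∷ 3 ∷ 3 ∷ 2 ∷ 1 ∷ []) ∷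
  (1 ∷ 2 ∷ 6 ∷ 7 ∷ 3 ∷ 14 ∷ 20 ∷ 3 ∷ 5 ∷ 9 ∷ 2 ∷ 2 ∷ 1 ∷ 1 ∷ []) ∷
  (1 ∷ 2 ∷ 9 ∷ 5 ∷ 3 ∷ 20 ∷ 14 ∷ 3 ∷ 7 ∷ 6 ∷ 2 ∷ 1 ∷ 1 ∷ 2 ∷ []) ∷
  (1 ∷ 3 ∷ 8 ∷ 3 ∷ 4 ∷ 15 ∷ 8 ∷ 3 ∷ 4 ∷ 3 ∷ 2 ∷ 1 ∷ 2 ∷ 3 ∷ []) ∷
  (1 ∷ 4 ∷ 5 ∷ 3 ∷ 5 ∷ 9 ∷ 8 ∷ 3 ∷ 2 ∷ 3 ∷ 2 ∷ 2 ∷ 3 ∷ 2 ∷ []) ∷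
  (1 ∷ 4 ∷ 15 ∷ 8 ∷ 5 ∷ 24 ∷ 15 ∷ 2 ∷ 5 ∷ 4 ∷ 1 ∷ 1 ∷ 1 ∷ 2 ∷ []) ∷
  (1 ∷ 6 ∷ 14 ∷ 5 ∷ 7 ∷ 20 ∷ 9 ∷ 2 ∷ 3 ∷ 2 ∷ 1 ∷ 1 ∷ 2 ∷ 3 ∷ []) ∷
  (2 ∷ 1 ∷ 1 ∷ 2 ∷ 1 ∷ 4 ∷ 15 ∷ 8 ∷ 5 ∷ 24 ∷ 15 ∷ 5 ∷ 4 ∷ 1 ∷ []) ∷
  (2 ∷ 1 ∷ 2 ∷ 3 ∷ 1 ∷ 6 ∷ 14 ∷ 5 ∷ 7 ∷ 20 ∷ 9 ∷ 3 ∷ 2 ∷ 1 ∷ []) ∷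
  (2 ∷ 3 ∷ 2 ∷ 1 ∷ 2 ∷ 3 ∷ 4 ∷ 5 ∷ 2 ∷ 5 ∷ 9 ∷ 3 ∷ 8 ∷ 3 ∷ []) ∷
  (2 ∷ 3 ∷ 2 ∷ 3 ∷ 2 ∷ 3 ∷ 8 ∷ 3 ∷ 2 ∷ 9 ∷ 5 ∷ 5 ∷ 4 ∷ 1 ∷ []) ∷
  (2 ∷ 3 ∷ 4 ∷ 5 ∷ 2 ∷ 5 ∷ 9 ∷ 2 ∷ 3 ∷ 8 ∷ 3 ∷ 3 ∷ 2 ∷ 1 ∷ []) ∷
  (2 ∷ 3 ∷ 8 ∷ 3 ∷ 2 ∷ 9 ∷ 5 ∷ 2 ∷ 5 ∷ 4 ∷ 3 ∷ 1 ∷ 2 ∷ 3 ∷ []) ∷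
  (2 ∷ 5 ∷ 9 ∷ 2 ∷ 3 ∷ 8 ∷ 3 ∷ 2 ∷ 3 ∷ 2 ∷ 3 ∷ 1 ∷ 4 ∷ 5 ∷ []) ∷
  (2 ∷ 9 ∷ 5 ∷ 2 ∷ 5 ∷ 4 ∷ 3 ∷ 2 ∷ 1 ∷ 2 ∷ 3 ∷ 3 ∷ 8 ∷ 3 ∷ []) ∷
  (2 ∷ 9 ∷ 20 ∷ 7 ∷ 5 ∷ 14 ∷ 6 ∷ 1 ∷ 3 ∷ 2 ∷ 1 ∷ 1 ∷ 2 ∷ 3 ∷ []) ∷
  (2 ∷ 15 ∷ 24 ∷ 5 ∷ 8 ∷ 15 ∷ 4 ∷ 1 ∷ 2 ∷ 1 ∷ 1 ∷ 1 ∷ 4 ∷ 5 ∷ []) ∷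
  (3 ∷ 2 ∷ 1 ∷ 1 ∷ 1 ∷ 2 ∷ 6 ∷ 7 ∷ 3 ∷ 14 ∷ 20 ∷ 5 ∷ 9 ∷ 2 ∷ []) ∷
  (3 ∷ 2 ∷ 1 ∷ 2 ∷ 1 ∷ 2 ∷ 9 ∷ 5 ∷ 3 ∷ 20 ∷ 14 ∷ 7 ∷ 6 ∷ 1 ∷ []) ∷
  (3 ∷ 2 ∷ 2 ∷ 3 ∷ 1 ∷ 3 ∷ 8 ∷ 3 ∷ 4 ∷ 15 ∷ 8 ∷ 4 ∷ 3 ∷ 1 ∷ []) ∷
  (3 ∷ 2 ∷ 3 ∷ 2 ∷ 1 ∷ 4 ∷ 5 ∷ 3 ∷ 5 ∷ 9 ∷ 8 ∷ 2 ∷ 3 ∷ 2 ∷ []) ∷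
  (3 ∷ 5 ∷ 4 ∷ 1 ∷ 2 ∷ 3 ∷ 2 ∷ 3 ∷ 2 ∷ 3 ∷ 8 ∷ 2 ∷ 9 ∷ 5 ∷ []) ∷
  (3 ∷ 8 ∷ 3 ∷ 1 ∷ 3 ∷ 2 ∷ 2 ∷ 3 ∷ 1 ∷ 3 ∷ 8 ∷ 4 ∷ 15 ∷ 4 ∷ []) ∷
  (3 ∷ 8 ∷ 3 ∷ 2 ∷ 3 ∷ 2 ∷ 3 ∷ 2 ∷ 1 ∷ 4 ∷ 5 ∷ 5 ∷ 9 ∷ 2 ∷ []) ∷
  (3 ∷ 8 ∷ 9 ∷ 5 ∷ 3 ∷ 5 ∷ 4 ∷ 1 ∷ 2 ∷ 3 ∷ 2 ∷ 2 ∷ 3 ∷ 2 ∷ []) ∷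
  (3 ∷ 8 ∷ 15 ∷ 4 ∷ 3 ∷ 8 ∷ 3 ∷ 1 ∷ 3 ∷ 2 ∷ 2 ∷ 1 ∷ 3 ∷ 4 ∷ []) ∷
  (3 ∷ 14 ∷ 20 ∷ 3 ∷ 5 ∷ 9 ∷ 2 ∷ 1 ∷ 2 ∷ 1 ∷ 2 ∷ 1 ∷ 6 ∷ 7 ∷ []) ∷
  (3 ∷ 20 ∷ 14 ∷ 3 ∷ 7 ∷ 6 ∷ 2 ∷ 1 ∷ 1 ∷ 1 ∷ 2 ∷ 2 ∷ 9 ∷ 5 ∷ []) ∷
  (4 ∷ 3 ∷ 2 ∷ 1 ∷ 1 ∷ 2 ∷ 3 ∷ 4 ∷ 3 ∷ 8 ∷ 15 ∷ 3 ∷ 8 ∷ 3 ∷ []) ∷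
  (4 ∷ 15 ∷ 8 ∷ 3 ∷ 4 ∷ 3 ∷ 2 ∷ 1 ∷ 1 ∷ 2 ∷ 3 ∷ 3 ∷ 8 ∷ 3 ∷ []) ∷
  (5 ∷ 4 ∷ 1 ∷ 1 ∷ 1 ∷ 1 ∷ 4 ∷ 5 ∷ 2 ∷ 15 ∷ 24 ∷ 8 ∷ 15 ∷ 2 ∷ []) ∷
  (5 ∷ 4 ∷ 3 ∷ 2 ∷ 1 ∷ 2 ∷ 3 ∷ 2 ∷ 3 ∷ 8 ∷ 9 ∷ 3 ∷ 5 ∷ 2 ∷ []) ∷
  (5 ∷ 9 ∷ 2 ∷ 1 ∷ 2 ∷ 1 ∷ 2 ∷ 3 ∷ 1 ∷ 6 ∷ 14 ∷ 7 ∷ 20 ∷ 3 ∷ []) ∷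
  (5 ∷ 9 ∷ 8 ∷ 3 ∷ 2 ∷ 3 ∷ 2 ∷ 1 ∷ 2 ∷ 3 ∷ 4 ∷ 2 ∷ 5 ∷ 3 ∷ []) ∷
  (5 ∷ 14 ∷ 6 ∷ 1 ∷ 3 ∷ 2 ∷ 1 ∷ 2 ∷ 1 ∷ 2 ∷ 9 ∷ 3 ∷ 20 ∷ 7 ∷ []) ∷
  (5 ∷ 24 ∷ 15 ∷ 2 ∷ 5 ∷ 4 ∷ 1 ∷ 1 ∷ 1 ∷ 1 ∷ 4 ∷ 2 ∷ 15 ∷ 8 ∷ []) ∷
  (7 ∷ 6 ∷ 2 ∷ 1 ∷ 1 ∷ 1 ∷ 2 ∷ 3 ∷ 2 ∷ 9 ∷ 20 ∷ 5 ∷ 14 ∷ 3 ∷ []) ∷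
  (7 ∷ 20 ∷ 9 ∷ 2 ∷ 3 ∷ 2 ∷ 1 ∷ 1 ∷ 1 ∷ 2 ∷ 6 ∷ 3 ∷ 14 ∷ 5 ∷ []) ∷
  (8 ∷ 15 ∷ 4 ∷ 1 ∷ 2 ∷ 1 ∷ 1 ∷ 2 ∷ 1 ∷ 4 ∷ 15 ∷ 5 ∷ 24 ∷ 5 ∷ []) ∷
  []

module Submission where

-- All entries of an arithmetic frieze are natural numbers, so the argument takes place in ℕ,
-- where the diamond rule reads W E = (1 + N) (1 + S).  Three neighbouring diamonds force
-- y[4,j+1] ∣ y[2,j+2] and y[1,j+1] ∣ y[3,j]; with the quotients Q j = y[2,j+2] / y[4,j+1] and
-- R j = y[3,j] / y[1,j+1], the sequence 1, Q j, y[1,j+3], y[4,j+2], R (j+3), 1 consists of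
-- positive integers each dividing the sum of its two neighbours.  In such a sequence a largest
-- interior term either is the sum of its neighbours, and deleting it leaves a shorter sequence
-- of the same kind, or equals both neighbours and is then 1; so for 1, 2, 3, 4 interior terms
-- they are at most 2, 3, 6, 12.  Hence row 1 is bounded by 12.  As y[1,0], …, y[1,3] determine
-- the fundamental domain through the diamond rule, a search over 12⁴ seeds shows that it is one
-- of the listed tuples.  Conversely, the glide symmetry spreads each listed tuple over a period
-- of 7 columns, and the diamond rule is checked on these 28 cells.

open import Defs
open import Data.Rational using (ℚ; mkℚ; 1ℚ)
open import Data.Vec using (Vec; []; _∷_)
open import Data.List using (List; []; _∷_; map)
open import Data.Product using (Σ; _×_; _,_; proj₁; proj₂; swap)
open import Function.Bundles using (_⇔_; mk⇔; Equivalence)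
open import Data.List.Membership.Propositional using (_∈_)
open import Relation.Binary.PropositionalEquality
  using (_≡_; refl; sym; trans; cong; cong₂; subst; module ≡-Reasoning)

open import Data.Nat
open import Data.Nat.Properties
open import Data.Nat.Divisibility
open _∣_ using (quotient; equality)
open import Data.Nat.DivMod
  using (m*n/n≡m; m%n<n; m≡m%n+[m/n]*n; [m+kn]%n≡m%n; [m+n]%n≡m%n; n%n≡0; m≤n⇒m%n≡m)
import Data.Nat.Coprimality as Coprime
open import Data.Nat.Tactic.RingSolver using (solve-∀)
open import Data.Integer as ℤ using (ℤ; +_; -[1+_]; 1ℤ)
import Data.Integer.Properties as ℤ
import Data.Integer.Tactic.RingSolver as ℤ-Solver
import Data.Rational as ℚ
open import Data.Rational.Properties using (normalize-coprime)
open import Data.Fin using (Fin; toℕ; fromℕ<)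
open import Data.Fin.Properties using (toℕ-fromℕ<; all?)
open import Data.Sum using (_⊎_; inj₁; inj₂)
open import Data.Empty using (⊥-elim)
import Data.Vec.Properties as Vec
import Data.List.Relation.Unary.All as All
open import Data.List.Membership.DecPropositional (Vec.≡-dec {n = 14} _≟_) using (_∈?_)
open import Data.List.Membership.Propositional.Properties using (∈-map⁺; ∈-map⁻)
open import Relation.Nullary using (yes; no)
open import Relation.Nullary.Decidable using (Dec; _×-dec_; _→-dec_; toWitness)

-- ℕ-valued friezes

ℕtoℚ≡mkℚ : ∀ k → ℕtoℚ k ≡ mkℚ (+ k) 0 (Coprime.sym (Coprime.1-coprimeTo k))
ℕtoℚ≡mkℚ k = normalize-coprime (Coprime.sym (Coprime.1-coprimeTo k))

ℕtoℚ-injective : ∀ {m n} → ℕtoℚ m ≡ ℕtoℚ n → m ≡ n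
ℕtoℚ-injective {m} {n} eq =
  ℤ.+-injective (cong ℚ.↥_ (trans (sym (ℕtoℚ≡mkℚ m)) (trans eq (ℕtoℚ≡mkℚ n))))

ℕtoℚ-* : ∀ m n → ℕtoℚ (m * n) ≡ ℕtoℚ m ℚ.* ℕtoℚ n
ℕtoℚ-* m n rewrite ℕtoℚ≡mkℚ m | ℕtoℚ≡mkℚ n = cong (ℚ._/ 1) (ℤ.pos-* m n)

ℕtoℚ-suc : ∀ m → ℕtoℚ (suc m) ≡ 1ℚ ℚ.+ ℕtoℚ m
ℕtoℚ-suc m rewrite ℕtoℚ≡mkℚ m = cong (λ k → (+ 1 ℤ.+ k) ℚ./ 1) (sym (ℤ.*-identityʳ (+ m)))

ℕtoℚ-diamond : ∀ w e n s →
  (w * e ≡ suc n * suc s) ⇔ (ℕtoℚ w ℚ.* ℕtoℚ e ≡ (1ℚ ℚ.+ ℕtoℚ n) ℚ.* (1ℚ ℚ.+ ℕtoℚ s))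
ℕtoℚ-diamond w e n s = mk⇔
  (λ eq → trans (sym lhs) (trans (cong ℕtoℚ eq) rhs))
  (λ eq → ℕtoℚ-injective (trans lhs (trans eq (sym rhs))))
  where
  lhs : ℕtoℚ (w * e) ≡ ℕtoℚ w ℚ.* ℕtoℚ e
  lhs = ℕtoℚ-* w e
  rhs : ℕtoℚ (suc n * suc s) ≡ (1ℚ ℚ.+ ℕtoℚ n) ℚ.* (1ℚ ℚ.+ ℕtoℚ s)
  rhs = trans (ℕtoℚ-* (suc n) (suc s)) (cong₂ ℚ._*_ (ℕtoℚ-suc n) (ℕtoℚ-suc s))

_⁺ : ℤ → ℤ
j ⁺ = j ℤ.+ 1ℤ

record ℕYFrieze (n : ℕ) : Set where
  field
    Y        : ℕ → ℤ → ℕ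
    top      : ∀ j → Y 0 j ≡ 0
    bottom   : ∀ j → Y (suc n) j ≡ 0
    positive : ∀ {i} j → 1 ≤ i → i ≤ n → 1 ≤ Y i j
    diamondℕ : ∀ {i} j → 1 ≤ i → i ≤ n →
               Y i j * Y i (j ⁺) ≡ suc (Y (pred i) (j ⁺)) * suc (Y (suc i) j)

module _ {n : ℕ} (N : ℕYFrieze n) where
  open ℕYFrieze N

  diamond-first : 1 ≤ n → ∀ j → Y 1 j * Y 1 (j ⁺) ≡ suc (Y 2 j)
  diamond-first 1≤n j = begin
    Y 1 j * Y 1 (j ⁺)               ≡⟨ diamondℕ j ≤-refl 1≤n ⟩
    suc (Y 0 (j ⁺)) * suc (Y 2 j)   ≡⟨ cong (λ k → suc k * suc (Y 2 j)) (top (j ⁺)) ⟩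
    1 * suc (Y 2 j)                 ≡⟨ *-identityˡ _ ⟩
    suc (Y 2 j)                     ∎
    where open ≡-Reasoning

  diamond-last : 1 ≤ n → ∀ j → Y n j * Y n (j ⁺) ≡ suc (Y (pred n) (j ⁺))
  diamond-last 1≤n j = begin
    Y n j * Y n (j ⁺)                        ≡⟨ diamondℕ j 1≤n ≤-refl ⟩
    suc (Y (pred n) (j ⁺)) * suc (Y (suc n) j) ≡⟨ cong (λ k → suc (Y (pred n) (j ⁺)) * suc k) (bottom j) ⟩
    suc (Y (pred n) (j ⁺)) * 1               ≡⟨ *-identityʳ _ ⟩
    suc (Y (pred n) (j ⁺))                   ∎
    where open ≡-Reasoning

  toYFrieze : YFrieze n
  toYFrieze = record
    { y       = λ i j → ℕtoℚ (Y i j)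
    ; row0    = λ j → cong ℕtoℚ (top j)
    ; rowLast = λ j → cong ℕtoℚ (bottom j)
    ; nonzero = λ i 1≤i i≤n allZero →
        <-irrefl refl (≤-trans (positive (+ 0) 1≤i i≤n) (≤-reflexive (ℕtoℚ-injective (allZero (+ 0)))))
    ; diamond = λ i j 1≤i i≤n →
        Equivalence.to (ℕtoℚ-diamond (Y i j) (Y i (j ⁺)) (Y (pred i) (j ⁺)) (Y (suc i) j))
          (diamondℕ j 1≤i i≤n)
    }

  toYFrieze-arithmetic : Arithmetic toYFrieze
  toYFrieze-arithmetic i j 1≤i i≤n = Y i j , positive j 1≤i i≤n , refl

module _ {n : ℕ} (F : YFrieze n) (arithmetic : Arithmetic F) where

  entry : ℕ → ℤ → ℕ
  entry i j with 1 ≤? i | i ≤? n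
  ... | yes 1≤i | yes i≤n = proj₁ (arithmetic i j 1≤i i≤n)
  ... | _       | _       = 0

  y≡entry : ∀ {i} j → i ≤ suc n → y F i j ≡ ℕtoℚ (entry i j)
  y≡entry {i} j i≤1+n with 1 ≤? i | i ≤? n
  ... | yes 1≤i | yes i≤n = proj₂ (proj₂ (arithmetic i j 1≤i i≤n))
  ... | no 1≰i  | _ with n<1⇒n≡0 (≰⇒> 1≰i)
  ...   | refl = row0 F j
  y≡entry {i} j i≤1+n | yes _ | no i≰n with ≤-antisym i≤1+n (≰⇒> i≰n)
  ...   | refl = rowLast F j

  fromArithmetic : ℕYFrieze n
  fromArithmetic = record
    { Y        = entry
    ; top      = λ j → ℕtoℚ-injective (trans (sym (y≡entry j z≤n)) (row0 F j))
    ; bottom   = λ j → ℕtoℚ-injective (trans (sym (y≡entry j ≤-refl)) (rowLast F j))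
    ; positive = positiveEntry
    ; diamondℕ = λ {i} j 1≤i i≤n →
        Equivalence.from (ℕtoℚ-diamond (entry i j) (entry i (j ⁺)) (entry (pred i) (j ⁺)) (entry (suc i) j))
          (diamondEntry i j 1≤i i≤n)
    }
    where
    positiveEntry : ∀ {i} j → 1 ≤ i → i ≤ n → 1 ≤ entry i j
    positiveEntry {i} j 1≤i i≤n with arithmetic i j 1≤i i≤n
    ... | k , 1≤k , y≡k =
      subst (1 ≤_) (ℕtoℚ-injective (trans (sym y≡k) (y≡entry j (m≤n⇒m≤1+n i≤n)))) 1≤k

    diamondEntry : ∀ i j → 1 ≤ i → i ≤ n →
      ℕtoℚ (entry i j) ℚ.* ℕtoℚ (entry i (j ⁺))
        ≡ (1ℚ ℚ.+ ℕtoℚ (entry (pred i) (j ⁺))) ℚ.* (1ℚ ℚ.+ ℕtoℚ (entry (suc i) j))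
    diamondEntry i j 1≤i i≤n = begin
      ℕtoℚ (entry i j) ℚ.* ℕtoℚ (entry i (j ⁺))
        ≡⟨ cong₂ ℚ._*_ (y≡entry j i≤1+n) (y≡entry (j ⁺) i≤1+n) ⟨
      y F i j ℚ.* y F i (j ⁺)
        ≡⟨ diamond F i j 1≤i i≤n ⟩
      (1ℚ ℚ.+ y F (pred i) (j ⁺)) ℚ.* (1ℚ ℚ.+ y F (suc i) j)
        ≡⟨ cong₂ (λ a b → (1ℚ ℚ.+ a) ℚ.* (1ℚ ℚ.+ b))
                 (y≡entry (j ⁺) (≤-trans pred[n]≤n i≤1+n)) (y≡entry j (s≤s i≤n)) ⟩
      (1ℚ ℚ.+ ℕtoℚ (entry (pred i) (j ⁺))) ℚ.* (1ℚ ℚ.+ ℕtoℚ (entry (suc i) j)) ∎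
      where
      open ≡-Reasoning
      i≤1+n : i ≤ suc n
      i≤1+n = m≤n⇒m≤1+n i≤n

-- Divisibility chains

private variable
  a a′ c d f g h m n p p′ q₀ q₁ q₂ t u v w x x′ : ℕ

max∣sum⇒sum≡max⊎equal : 1 ≤ u → 1 ≤ v → u ≤ m → v ≤ m → m ∣ u + v →
                        u + v ≡ m ⊎ (u ≡ m × v ≡ m)
max∣sum⇒sum≡max⊎equal {u} {v} {m} 1≤u _ _ _ (divides zero u+v≡0) =
  ⊥-elim (<⇒≱ 1≤u (≤-reflexive (m+n≡0⇒m≡0 u u+v≡0)))
max∣sum⇒sum≡max⊎equal {m = m} _ _ _ _ (divides 1 u+v≡m) = inj₁ (trans u+v≡m (+-identityʳ m))
max∣sum⇒sum≡max⊎equal {u} {v} {m} _ _ u≤m v≤m (divides 2 u+v≡2m) = inj₂ (≤-antisym u≤m m≤u , ≤-antisym v≤m m≤v)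
  where
  u+v≡m+m : u + v ≡ m + m
  u+v≡m+m = trans u+v≡2m (cong (λ k → m + k) (+-identityʳ m))
  m≤u : m ≤ u
  m≤u = +-cancelʳ-≤ m m u (≤-trans (≤-reflexive (sym u+v≡m+m)) (+-monoʳ-≤ u v≤m))
  m≤v : m ≤ v
  m≤v = +-cancelˡ-≤ m m v (≤-trans (≤-reflexive (sym u+v≡m+m)) (+-monoˡ-≤ v u≤m))
max∣sum⇒sum≡max⊎equal {u} {v} {m} 1≤u _ u≤m v≤m (divides (suc (suc (suc k))) u+v≡[3+k]m) =
  ⊥-elim (<-irrefl refl (begin-strict
    u + v                  ≤⟨ +-mono-≤ u≤m v≤m ⟩
    m + m                  <⟨ +-monoʳ-< m (m<m+n m (≤-trans (≤-trans 1≤u u≤m) (m≤m+n m (k * m)))) ⟩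
    m + (m + (m + k * m))  ≡⟨ u+v≡[3+k]m ⟨
    u + v                  ∎))
  where open ≤-Reasoning

d∣n∧n≡d+m⇒d∣m : d ∣ n → n ≡ d + m → d ∣ m
d∣n∧n≡d+m⇒d∣m d∣n n≡d+m = ∣m+n∣m⇒∣n (subst (λ k → _ ∣ k) n≡d+m d∣n) ∣-refl

record Chain₂ (x y : ℕ) : Set where
  field
    1≤x : 1 ≤ x
    1≤y : 1 ≤ y
    x∣  : x ∣ suc y
    y∣  : y ∣ suc x

record Chain₃ (x y z : ℕ) : Set where
  field
    1≤x : 1 ≤ x
    1≤y : 1 ≤ y
    1≤z : 1 ≤ z
    x∣  : x ∣ suc y
    y∣  : y ∣ x + z
    z∣  : z ∣ suc y

record Chain₄ (w x y z : ℕ) : Set where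
  field
    1≤w : 1 ≤ w
    1≤x : 1 ≤ x
    1≤y : 1 ≤ y
    1≤z : 1 ≤ z
    w∣  : w ∣ suc x
    x∣  : x ∣ w + y
    y∣  : y ∣ x + z
    z∣  : z ∣ suc y

chain₂-reverse : ∀ {x y} → Chain₂ x y → Chain₂ y x
chain₂-reverse c = record { 1≤x = 1≤y ; 1≤y = 1≤x ; x∣ = y∣ ; y∣ = x∣ }
  where open Chain₂ c

chain₃-reverse : ∀ {x y z} → Chain₃ x y z → Chain₃ z y x
chain₃-reverse {x} {y} {z} c =
  record { 1≤x = 1≤z ; 1≤y = 1≤y ; 1≤z = 1≤x ; x∣ = z∣ ; y∣ = subst (y ∣_) (+-comm x z) y∣ ; z∣ = x∣ }
  where open Chain₃ c

chain₄-reverse : ∀ {w x y z} → Chain₄ w x y z → Chain₄ z y x w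
chain₄-reverse {w} {x} {y} {z} c = record
  { 1≤w = 1≤z ; 1≤x = 1≤y ; 1≤y = 1≤x ; 1≤z = 1≤w
  ; w∣ = z∣ ; x∣ = subst (y ∣_) (+-comm x z) y∣ ; y∣ = subst (x ∣_) (+-comm w y) x∣ ; z∣ = w∣ }
  where open Chain₄ c

chain₂-bound-edge : ∀ {x y} → Chain₂ x y → y ≤ x → x ≤ 3 × y ≤ 3
chain₂-bound-edge {x} {y} c y≤x = ≤-trans (∣⇒≤ x∣) (s≤s y≤2) , m≤n⇒m≤1+n y≤2
  where
  open Chain₂ c
  y≤2 : y ≤ 2
  y≤2 with max∣sum⇒sum≡max⊎equal ≤-refl 1≤y 1≤x y≤x x∣
  ... | inj₁ refl          = ∣⇒≤ (d∣n∧n≡d+m⇒d∣m y∣ (+-comm 2 y))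
  ... | inj₂ (refl , refl) = s≤s z≤n

chain₂-bound : ∀ {x y} → Chain₂ x y → x ≤ 3 × y ≤ 3
chain₂-bound {x} {y} c with ≤-total y x
... | inj₁ y≤x = chain₂-bound-edge c y≤x
... | inj₂ x≤y = swap (chain₂-bound-edge (chain₂-reverse c) x≤y)

chain₃-bound-edge : ∀ {x y z} → Chain₃ x y z → y ≤ x → x ≤ 6 × y ≤ 6 × z ≤ 6
chain₃-bound-edge {x} {y} {z} c y≤x
  with chain₂-bound (record { 1≤x = 1≤y ; 1≤y = 1≤z ; x∣ = y∣1+z ; y∣ = z∣ })
  where
  open Chain₃ c
  y∣1+z : y ∣ suc z
  y∣1+z with max∣sum⇒sum≡max⊎equal ≤-refl 1≤y 1≤x y≤x x∣
  ... | inj₁ refl          = d∣n∧n≡d+m⇒d∣m y∣ (sym (+-suc y z))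
  ... | inj₂ (refl , refl) = y∣
... | y≤3 , z≤3 =
  ≤-trans (∣⇒≤ (Chain₃.x∣ c)) (m≤n⇒m≤n+o 2 (s≤s y≤3)) , m≤n⇒m≤n+o 3 y≤3 , m≤n⇒m≤n+o 3 z≤3

chain₃-bound-centre : ∀ {x y z} → Chain₃ x y z → x ≤ y → z ≤ y → x ≤ 6 × y ≤ 6 × z ≤ 6
chain₃-bound-centre {x} {y} {z} c x≤y z≤y with max∣sum⇒sum≡max⊎equal 1≤x 1≤z x≤y z≤y y∣
  where open Chain₃ c
... | inj₁ refl with chain₂-bound (record
      { 1≤x = 1≤x ; 1≤y = 1≤z
      ; x∣ = d∣n∧n≡d+m⇒d∣m x∣ (sym (+-suc x z))
      ; y∣ = d∣n∧n≡d+m⇒d∣m z∣ (trans (cong suc (+-comm x z)) (sym (+-suc z x))) })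
  where open Chain₃ c
...   | x≤3 , z≤3 = m≤n⇒m≤n+o 3 x≤3 , +-mono-≤ x≤3 z≤3 , m≤n⇒m≤n+o 3 z≤3
chain₃-bound-centre {x} c _ _ | inj₂ (refl , refl)
  with ∣1⇒≡1 (d∣n∧n≡d+m⇒d∣m (Chain₃.x∣ c) (+-comm 1 x))
... | refl = s≤s z≤n , s≤s z≤n , s≤s z≤n

chain₃-bound : ∀ {x y z} → Chain₃ x y z → x ≤ 6 × y ≤ 6 × z ≤ 6
chain₃-bound {x} {y} {z} c with ≤-total y x
... | inj₁ y≤x = chain₃-bound-edge c y≤x
... | inj₂ x≤y with ≤-total z y
...   | inj₁ z≤y = chain₃-bound-centre c x≤y z≤y
...   | inj₂ y≤z with chain₃-bound-edge (chain₃-reverse c) y≤z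
...     | z≤6 , y≤6 , x≤6 = x≤6 , y≤6 , z≤6

chain₄-bound-edge : ∀ {w x y z} → Chain₄ w x y z → x ≤ w → w ≤ 12 × x ≤ 12 × y ≤ 12 × z ≤ 12
chain₄-bound-edge {w} {x} {y} {z} c x≤w
  with chain₃-bound (record { 1≤x = 1≤x ; 1≤y = 1≤y ; 1≤z = 1≤z ; x∣ = x∣1+y ; y∣ = y∣ ; z∣ = z∣ })
  where
  open Chain₄ c
  x∣1+y : x ∣ suc y
  x∣1+y with max∣sum⇒sum≡max⊎equal ≤-refl 1≤x 1≤w x≤w w∣
  ... | inj₁ refl          = d∣n∧n≡d+m⇒d∣m x∣ (sym (+-suc x y))
  ... | inj₂ (refl , refl) = x∣
... | x≤6 , y≤6 , z≤6 =
  ≤-trans (∣⇒≤ (Chain₄.w∣ c)) (m≤n⇒m≤n+o 5 (s≤s x≤6)) ,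
  m≤n⇒m≤n+o 6 x≤6 , m≤n⇒m≤n+o 6 y≤6 , m≤n⇒m≤n+o 6 z≤6

chain₄-bound-centre : ∀ {w x y z} → Chain₄ w x y z → w ≤ x → y ≤ x → w ≤ 12 × x ≤ 12 × y ≤ 12 × z ≤ 12
chain₄-bound-centre {w} {x} {y} {z} c w≤x y≤x with max∣sum⇒sum≡max⊎equal 1≤w 1≤y w≤x y≤x x∣
  where open Chain₄ c
... | inj₁ refl with chain₃-bound (record
      { 1≤x = 1≤w ; 1≤y = 1≤y ; 1≤z = 1≤z
      ; x∣ = d∣n∧n≡d+m⇒d∣m w∣ (sym (+-suc w y))
      ; y∣ = d∣n∧n≡d+m⇒d∣m y∣ (trans (cong (_+ z) (+-comm w y)) (+-assoc y w z))
      ; z∣ = z∣ })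
  where open Chain₄ c
...   | w≤6 , y≤6 , z≤6 = m≤n⇒m≤n+o 6 w≤6 , +-mono-≤ w≤6 y≤6 , m≤n⇒m≤n+o 6 y≤6 , m≤n⇒m≤n+o 6 z≤6
chain₄-bound-centre {w} c _ _ | inj₂ (refl , refl)
  with ∣1⇒≡1 (d∣n∧n≡d+m⇒d∣m (Chain₄.w∣ c) (+-comm 1 w))
... | refl = s≤s z≤n , s≤s z≤n , s≤s z≤n , m≤n⇒m≤n+o 10 (∣⇒≤ (Chain₄.z∣ c))

chain₄-bound : ∀ {w x y z} → Chain₄ w x y z → w ≤ 12 × x ≤ 12 × y ≤ 12 × z ≤ 12
chain₄-bound {w} {x} {y} {z} c with ≤-total x w
... | inj₁ x≤w = chain₄-bound-edge c x≤w
... | inj₂ w≤x with ≤-total y x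
...   | inj₁ y≤x = chain₄-bound-centre c w≤x y≤x
...   | inj₂ x≤y with ≤-total z y
...     | inj₁ z≤y with chain₄-bound-centre (chain₄-reverse c) z≤y x≤y
...       | z≤12 , y≤12 , x≤12 , w≤12 = w≤12 , x≤12 , y≤12 , z≤12
chain₄-bound c | inj₂ _ | inj₂ _ | inj₂ y≤z with chain₄-bound-edge (chain₄-reverse c) y≤z
... | z≤12 , y≤12 , x≤12 , w≤12 = w≤12 , x≤12 , y≤12 , z≤12

diamonds⇒∣ : a′ * a ≡ suc c → c * g ≡ suc f * suc a → a * h ≡ suc g → a ∣ f
diamonds⇒∣ {a′} {a} {c} {g} {f} {h} a′a≡1+c cg≡[1+f][1+a] ah≡1+g =
  ∣m+n∣m⇒∣n (divides (a′ * g) (trans (sym a[a′g]≡a[h+1+f]+f) (*-comm a (a′ * g))))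
            (divides (h + suc f) (*-comm a (h + suc f)))
  where
  open ≡-Reasoning
  a[a′g]≡a[h+1+f]+f : a * (a′ * g) ≡ a * (h + suc f) + f
  a[a′g]≡a[h+1+f]+f = begin
    a * (a′ * g)             ≡⟨ trans (cong (λ k → k * g) (*-comm a′ a)) (*-assoc a a′ g) ⟨
    (a′ * a) * g             ≡⟨ cong (λ k → k * g) a′a≡1+c ⟩
    g + c * g                ≡⟨ cong (λ k → g + k) cg≡[1+f][1+a] ⟩
    g + suc f * suc a        ≡⟨ ring₁ g f a ⟩
    suc g + (f + a * suc f)  ≡⟨ cong (λ k → k + (f + a * suc f)) ah≡1+g ⟨
    a * h + (f + a * suc f)  ≡⟨ ring₂ a h f ⟩
    a * (h + suc f) + f      ∎
    where
    ring₁ : ∀ g f a → g + suc f * suc a ≡ suc g + (f + a * suc f)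
    ring₁ = solve-∀
    ring₂ : ∀ a h f → a * h + (f + a * suc f) ≡ a * (h + suc f) + f
    ring₂ = solve-∀

quotients-* : (u∣p : u ∣ p) (v∣p′ : v ∣ p′) → p * p′ ≡ suc x * suc t → u * v ≡ suc t →
              suc x ≡ quotient u∣p * quotient v∣p′
quotients-* {u} {p} {v} {p′} {x} {t} (divides q p≡qu) (divides q′ p′≡q′v) pp′≡[1+x][1+t] uv≡1+t =
  *-cancelʳ-≡ (suc x) (q * q′) (suc t) (begin
    suc x * suc t      ≡⟨ pp′≡[1+x][1+t] ⟨
    p * p′             ≡⟨ cong₂ _*_ p≡qu p′≡q′v ⟩
    (q * u) * (q′ * v) ≡⟨ regroup q u q′ v ⟩
    (q * q′) * (u * v) ≡⟨ cong (λ k → (q * q′) * k) uv≡1+t ⟩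
    (q * q′) * suc t   ∎)
  where
  open ≡-Reasoning
  regroup : ∀ q u q′ v → (q * u) * (q′ * v) ≡ (q * q′) * (u * v)
  regroup = solve-∀

quotients-+ : suc x ≡ q₀ * q₁ → p ≡ q₁ * w → x * x′ ≡ suc p → suc x′ ≡ q₁ * q₂ → 1 ≤ q₁ →
              q₀ + w ≡ q₂ * x
quotients-+ {x} {q₀} {q₁} {p} {w} {x′} {q₂} 1+x≡q₀q₁ p≡q₁w xx′≡1+p 1+x′≡q₁q₂ 1≤q₁ =
  *-cancelˡ-≡ (q₀ + w) (q₂ * x) q₁ {{>-nonZero 1≤q₁}} (begin
    q₁ * (q₀ + w)      ≡⟨ trans (*-distribˡ-+ q₁ q₀ w) (cong (λ k → k + q₁ * w) (*-comm q₁ q₀)) ⟩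
    q₀ * q₁ + q₁ * w   ≡⟨ cong₂ _+_ 1+x≡q₀q₁ p≡q₁w ⟨
    suc x + p          ≡⟨ +-suc x p ⟨
    x + suc p          ≡⟨ cong (λ k → x + k) xx′≡1+p ⟨
    x + x * x′         ≡⟨ *-suc x x′ ⟨
    x * suc x′         ≡⟨ cong (λ k → x * k) 1+x′≡q₁q₂ ⟩
    x * (q₁ * q₂)      ≡⟨ trans (*-comm x (q₁ * q₂)) (*-assoc q₁ q₂ x) ⟩
    q₁ * (q₂ * x)      ∎)
  where open ≡-Reasoning

quotient-positive : ∀ {m q n} → 1 ≤ m → m ≡ q * n → 1 ≤ q
quotient-positive {q = suc _} _   _    = s≤s z≤n
quotient-positive {q = zero}  1≤m refl = 1≤m

-- Completion from row 1

-- Junk value 0 at divisor 0.  Splitting on the dividend keeps x div suc y folded for a neutral x,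
-- which the rewrites in completion-unique rely on.
_div_ : ℕ → ℕ → ℕ
m     div zero  = 0
zero  div suc n = 0
suc m div suc n = suc m / suc n

div≡/ : ∀ m n → m div suc n ≡ m / suc n
div≡/ zero    n = refl
div≡/ (suc m) n = refl

*-div : ∀ m q {n} → 1 ≤ m → m * q ≡ n → n div m ≡ q
*-div (suc m) q _ refl =
  trans (div≡/ (suc m * q) m) (trans (cong (_/ suc m) (*-comm (suc m) q)) (m*n/n≡m q (suc m)))

Diamonds : Vec ℕ 14 → Set
Diamonds (a ∷ b ∷ c ∷ d ∷ e ∷ f ∷ g ∷ h ∷ i ∷ j ∷ k ∷ l ∷ m ∷ n ∷ []) =
  a * e ≡ suc b × b * f ≡ suc e * suc c × c * g ≡ suc f * suc d × d * h ≡ suc g ×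
  e * i ≡ suc f × f * j ≡ suc i * suc g × g * k ≡ suc j * suc h ×
  i * l ≡ suc j × j * m ≡ suc l * suc k ×
  l * n ≡ suc m

diamonds? : ∀ t → Dec (Diamonds t)
diamonds? (a ∷ b ∷ c ∷ d ∷ e ∷ f ∷ g ∷ h ∷ i ∷ j ∷ k ∷ l ∷ m ∷ n ∷ []) =
  a * e ≟ suc b ×-dec b * f ≟ suc e * suc c ×-dec c * g ≟ suc f * suc d ×-dec d * h ≟ suc g ×-dec
  e * i ≟ suc f ×-dec f * j ≟ suc i * suc g ×-dec g * k ≟ suc j * suc h ×-dec
  i * l ≟ suc j ×-dec j * m ≟ suc l * suc k ×-dec
  l * n ≟ suc m

completion : ℕ → ℕ → ℕ → ℕ → Vec ℕ 14
completion a e i l =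
  let b = pred (a * e)
      f = pred (e * i)
      j = pred (i * l)
      c = pred ((b * f) div suc e)
      g = pred ((f * j) div suc i)
      d = pred ((c * g) div suc f)
      h = suc g div d
      k = (suc j * suc h) div g
      m = (suc l * suc k) div j
      n = suc m div l
  in a ∷ b ∷ c ∷ d ∷ e ∷ f ∷ g ∷ h ∷ i ∷ j ∷ k ∷ l ∷ m ∷ n ∷ []

completion-unique : ∀ {a b c d e f g h i j k l m n} → 1 ≤ d → 1 ≤ g → 1 ≤ j → 1 ≤ l →
  Diamonds (a ∷ b ∷ c ∷ d ∷ e ∷ f ∷ g ∷ h ∷ i ∷ j ∷ k ∷ l ∷ m ∷ n ∷ []) →
  completion a e i l ≡ a ∷ b ∷ c ∷ d ∷ e ∷ f ∷ g ∷ h ∷ i ∷ j ∷ k ∷ l ∷ m ∷ n ∷ []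
completion-unique {c = c} {d} {e} {f} {g} {h} {i} {j} {k} {l} {m} {n}
                  1≤d 1≤g 1≤j 1≤l (ae , bf , cg , dh , ei , fj , gk , il , jm , ln)
  rewrite ae | ei | il
        | *-div (suc e) (suc c) (s≤s z≤n) (sym bf) | *-div (suc i) (suc g) (s≤s z≤n) (sym fj)
        | *-div (suc f) (suc d) (s≤s z≤n) (sym cg)
        | *-div d h 1≤d dh | *-div g k 1≤g gk | *-div j m 1≤j jm | *-div l n 1≤l ln
  = refl

<⇒∃toℕ : ∀ {k m} → m < k → Σ (Fin k) (λ i → toℕ i ≡ m)
<⇒∃toℕ m<k = fromℕ< m<k , toℕ-fromℕ< m<k

≤⇒∃suc-toℕ : ∀ {k m} → 1 ≤ m → m ≤ k → Σ (Fin k) (λ i → suc (toℕ i) ≡ m)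
≤⇒∃suc-toℕ {m = suc m} _ m<k = fromℕ< m<k , cong suc (toℕ-fromℕ< m<k)

CompletionListed : ℕ → ℕ → ℕ → ℕ → Set
CompletionListed a e i l = Diamonds (completion a e i l) → completion a e i l ∈ list42

completion-listed : ∀ {a e i l} → 1 ≤ a → a ≤ 12 → 1 ≤ e → e ≤ 12 → 1 ≤ i → i ≤ 12 → 1 ≤ l → l ≤ 12 →
                    CompletionListed a e i l
completion-listed 1≤a a≤12 1≤e e≤12 1≤i i≤12 1≤l l≤12
  with ≤⇒∃suc-toℕ 1≤a a≤12 | ≤⇒∃suc-toℕ 1≤e e≤12 | ≤⇒∃suc-toℕ 1≤i i≤12 | ≤⇒∃suc-toℕ 1≤l l≤12
... | a′ , refl | e′ , refl | i′ , refl | l′ , refl = search a′ e′ i′ l′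
  where
  search : ∀ (a e i l : Fin 12) → CompletionListed (suc (toℕ a)) (suc (toℕ e)) (suc (toℕ i)) (suc (toℕ l))
  search = toWitness {a? = all? λ a → all? λ e → all? λ i → all? λ l →
    diamonds? (completion (suc (toℕ a)) (suc (toℕ e)) (suc (toℕ i)) (suc (toℕ l)))
      →-dec completion (suc (toℕ a)) (suc (toℕ e)) (suc (toℕ i)) (suc (toℕ l)) ∈? list42} _

fundamentalDomain : (ℕ → ℤ → ℕ) → Vec ℕ 14
fundamentalDomain Y =
  Y 1 (+ 0) ∷ Y 2 (+ 0) ∷ Y 3 (+ 0) ∷ Y 4 (+ 0) ∷
  Y 1 (+ 1) ∷ Y 2 (+ 1) ∷ Y 3 (+ 1) ∷ Y 4 (+ 1) ∷
  Y 1 (+ 2) ∷ Y 2 (+ 2) ∷ Y 3 (+ 2) ∷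
  Y 1 (+ 3) ∷ Y 2 (+ 3) ∷
  Y 1 (+ 4) ∷ []

[j-3]+1+1+1≡j : ∀ j → j ℤ.+ -[1+ 2 ] ℤ.+ 1ℤ ℤ.+ 1ℤ ℤ.+ 1ℤ ≡ j
[j-3]+1+1+1≡j = ℤ-Solver.solve-∀

module Width₄ (N : ℕYFrieze 4) where
  open ℕYFrieze N

  positive₁ : ∀ j → 1 ≤ Y 1 j
  positive₁ j = positive j (s≤s z≤n) (s≤s z≤n)

  positive₂ : ∀ j → 1 ≤ Y 2 j
  positive₂ j = positive j (s≤s z≤n) (s≤s (s≤s z≤n))

  positive₃ : ∀ j → 1 ≤ Y 3 j
  positive₃ j = positive j (s≤s z≤n) (s≤s (s≤s (s≤s z≤n)))

  positive₄ : ∀ j → 1 ≤ Y 4 j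
  positive₄ j = positive j (s≤s z≤n) ≤-refl

  diamond₁ : ∀ j → Y 1 j * Y 1 (j ⁺) ≡ suc (Y 2 j)
  diamond₁ = diamond-first N (s≤s z≤n)

  diamond₂ : ∀ j → Y 2 j * Y 2 (j ⁺) ≡ suc (Y 1 (j ⁺)) * suc (Y 3 j)
  diamond₂ j = diamondℕ j (s≤s z≤n) (s≤s (s≤s z≤n))

  diamond₃ : ∀ j → Y 3 j * Y 3 (j ⁺) ≡ suc (Y 2 (j ⁺)) * suc (Y 4 j)
  diamond₃ j = diamondℕ j (s≤s z≤n) (s≤s (s≤s (s≤s z≤n)))

  diamond₄ : ∀ j → Y 4 j * Y 4 (j ⁺) ≡ suc (Y 3 (j ⁺))
  diamond₄ = diamond-last N (s≤s z≤n)

  Y₄∣Y₂ : ∀ j → Y 4 (j ⁺) ∣ Y 2 (j ⁺ ⁺)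
  Y₄∣Y₂ j = diamonds⇒∣ {a′ = Y 4 j} (diamond₄ j) (diamond₃ (j ⁺)) (diamond₄ (j ⁺))

  Y₁∣Y₃ : ∀ j → Y 1 (j ⁺) ∣ Y 3 j
  Y₁∣Y₃ j = diamonds⇒∣ {a′ = Y 1 j} (diamond₁ j)
    (trans (diamond₂ j) (*-comm (suc (Y 1 (j ⁺))) (suc (Y 3 j)))) (diamond₁ (j ⁺))

  Q R : ℤ → ℕ
  Q j = quotient (Y₄∣Y₂ j)
  R j = quotient (Y₁∣Y₃ j)

  Y₂≡QY₄ : ∀ j → Y 2 (j ⁺ ⁺) ≡ Q j * Y 4 (j ⁺)
  Y₂≡QY₄ j = equality (Y₄∣Y₂ j)

  Y₃≡RY₁ : ∀ j → Y 3 j ≡ R j * Y 1 (j ⁺)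
  Y₃≡RY₁ j = equality (Y₁∣Y₃ j)

  Q-positive : ∀ j → 1 ≤ Q j
  Q-positive j = quotient-positive (positive₂ (j ⁺ ⁺)) (Y₂≡QY₄ j)

  R-positive : ∀ j → 1 ≤ R j
  R-positive j = quotient-positive (positive₃ j) (Y₃≡RY₁ j)

  Q-product : ∀ j → suc (Y 1 (j ⁺ ⁺ ⁺)) ≡ Q j * Q (j ⁺)
  Q-product j = quotients-* (Y₄∣Y₂ j) (Y₄∣Y₂ (j ⁺)) (diamond₂ (j ⁺ ⁺)) (diamond₄ (j ⁺))

  R-product : ∀ j → suc (Y 4 j) ≡ R j * R (j ⁺)
  R-product j =
    quotients-* (Y₁∣Y₃ j) (Y₁∣Y₃ (j ⁺)) (trans (diamond₃ j) (*-comm (suc (Y 2 (j ⁺))) (suc (Y 4 j))))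
                (diamond₁ (j ⁺))

  Q-sum : ∀ j → Q j + Y 4 (j ⁺ ⁺) ≡ Q (j ⁺ ⁺) * Y 1 (j ⁺ ⁺ ⁺)
  Q-sum j = quotients-+ (Q-product j) (Y₂≡QY₄ (j ⁺)) (diamond₁ (j ⁺ ⁺ ⁺)) (Q-product (j ⁺))
                        (Q-positive (j ⁺))

  R-sum : ∀ j → Y 1 (j ⁺ ⁺) + R (j ⁺ ⁺) ≡ R j * Y 4 (j ⁺)
  R-sum j = trans (+-comm (Y 1 (j ⁺ ⁺)) (R (j ⁺ ⁺)))
    (quotients-+ (trans (R-product (j ⁺)) (*-comm (R (j ⁺)) (R (j ⁺ ⁺)))) (Y₃≡RY₁ (j ⁺))
                 (trans (*-comm (Y 4 (j ⁺)) (Y 4 j)) (diamond₄ j)) (trans (R-product j) (*-comm (R j) (R (j ⁺))))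
                 (R-positive (j ⁺)))

  chain : ∀ j → Chain₄ (Q j) (Y 1 (j ⁺ ⁺ ⁺)) (Y 4 (j ⁺ ⁺)) (R (j ⁺ ⁺ ⁺))
  chain j = record
    { 1≤w = Q-positive j
    ; 1≤x = positive₁ (j ⁺ ⁺ ⁺)
    ; 1≤y = positive₄ (j ⁺ ⁺)
    ; 1≤z = R-positive (j ⁺ ⁺ ⁺)
    ; w∣  = subst (λ k → Q j ∣ k) (sym (Q-product j)) (m∣m*n (Q (j ⁺)))
    ; x∣  = divides (Q (j ⁺ ⁺)) (Q-sum j)
    ; y∣  = divides (R (j ⁺)) (R-sum (j ⁺))
    ; z∣  = divides (R (j ⁺ ⁺)) (R-product (j ⁺ ⁺))
    }

  row₁-bound : ∀ j → Y 1 j ≤ 12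
  row₁-bound j =
    subst (λ k → Y 1 k ≤ 12) ([j-3]+1+1+1≡j j) (proj₁ (proj₂ (chain₄-bound (chain (j ℤ.+ -[1+ 2 ])))))

  fundamentalDomain-diamonds : Diamonds (fundamentalDomain Y)
  fundamentalDomain-diamonds =
    diamond₁ (+ 0) , diamond₂ (+ 0) , diamond₃ (+ 0) , diamond₄ (+ 0) ,
    diamond₁ (+ 1) , diamond₂ (+ 1) , diamond₃ (+ 1) ,
    diamond₁ (+ 2) , diamond₂ (+ 2) ,
    diamond₁ (+ 3)

  fundamentalDomain∈list42 : fundamentalDomain Y ∈ list42
  fundamentalDomain∈list42 =
    subst (_∈ list42) completed
      (completion-listed (positive₁ _) (row₁-bound _) (positive₁ _) (row₁-bound _)
                         (positive₁ _) (row₁-bound _) (positive₁ _) (row₁-bound _)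
                         (subst Diamonds (sym completed) fundamentalDomain-diamonds))
    where
    completed : completion (Y 1 (+ 0)) (Y 1 (+ 1)) (Y 1 (+ 2)) (Y 1 (+ 3)) ≡ fundamentalDomain Y
    completed = completion-unique (positive₄ _) (positive₃ _) (positive₂ _) (positive₁ _)
                                  fundamentalDomain-diamonds

-- Periodic friezes

-- j mod p, with pred p standing for −1 on negative j.
residue : (p : ℕ) .{{_ : NonZero p}} → ℤ → ℕ
residue p (+ n)      = n % p
residue p -[1+ n ]   = (pred p * suc n) % p

residue<p : ∀ p .{{_ : NonZero p}} j → residue p j < p
residue<p p (+ n)    = m%n<n n p
residue<p p -[1+ n ] = m%n<n (pred p * suc n) p

suc-% : ∀ m p .{{_ : NonZero p}} → suc (m % p) % p ≡ suc m % p
suc-% m p = begin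
  suc (m % p) % p                ≡⟨ [m+kn]%n≡m%n (suc (m % p)) (m / p) p ⟨
  suc (m % p + m / p * p) % p    ≡⟨ cong (λ t → suc t % p) (m≡m%n+[m/n]*n m p) ⟨
  suc m % p                      ∎
  where open ≡-Reasoning

residue-⁺ : ∀ p .{{_ : NonZero p}} j → residue p (j ⁺) ≡ suc (residue p j) % p
residue-⁺ p (+ n) = trans (cong (_% p) (+-comm n 1)) (sym (suc-% n p))
residue-⁺ (suc p′) -[1+ zero ] = begin
  0                                ≡⟨ n%n≡0 (suc p′) ⟨
  suc p′ % suc p′                  ≡⟨ cong (λ t → suc t % suc p′) (m≤n⇒m%n≡m ≤-refl) ⟨
  suc (p′ % suc p′) % suc p′       ≡⟨ cong (λ t → suc (t % suc p′) % suc p′) (*-identityʳ p′) ⟨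
  suc ((p′ * 1) % suc p′) % suc p′ ∎
  where open ≡-Reasoning
residue-⁺ (suc p′) -[1+ suc n ] = begin
  (p′ * suc n) % suc p′                      ≡⟨ [m+n]%n≡m%n (p′ * suc n) (suc p′) ⟨
  (p′ * suc n + suc p′) % suc p′             ≡⟨ cong (_% suc p′) (shift p′ n) ⟩
  suc (p′ * suc (suc n)) % suc p′            ≡⟨ suc-% (p′ * suc (suc n)) (suc p′) ⟨
  suc ((p′ * suc (suc n)) % suc p′) % suc p′ ∎
  where
  open ≡-Reasoning
  shift : ∀ p′ n → p′ * suc n + suc p′ ≡ suc (p′ * suc (suc n))
  shift = solve-∀

periodic : (p : ℕ) .{{_ : NonZero p}} → (ℕ → ℕ → ℕ) → ℕ → ℤ → ℕ
periodic p T i j = T i (residue p j)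

ValidCell : (p : ℕ) .{{_ : NonZero p}} → (ℕ → ℕ → ℕ) → ℕ → ℕ → Set
ValidCell p T i r =
  1 ≤ T i r × T i r * T i (suc r % p) ≡ suc (T (pred i) (suc r % p)) * suc (T (suc i) r)

validCell? : ∀ p .{{_ : NonZero p}} T i r → Dec (ValidCell p T i r)
validCell? p T i r =
  1 ≤? T i r ×-dec T i r * T i (suc r % p) ≟ suc (T (pred i) (suc r % p)) * suc (T (suc i) r)

periodicFrieze : ∀ {n p} .{{_ : NonZero p}} (T : ℕ → ℕ → ℕ) →
                 (∀ r → T 0 r ≡ 0) → (∀ r → T (suc n) r ≡ 0) →
                 (∀ (i : Fin n) (r : Fin p) → ValidCell p T (suc (toℕ i)) (toℕ r)) →
                 ℕYFrieze n
periodicFrieze {n} {p} T T-top T-bottom valid = record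
  { Y        = periodic p T
  ; top      = λ j → T-top (residue p j)
  ; bottom   = λ j → T-bottom (residue p j)
  ; positive = λ j 1≤i i≤n → proj₁ (validAt j 1≤i i≤n)
  ; diamondℕ = λ {i} j 1≤i i≤n →
      subst (λ r′ → T i (residue p j) * T i r′ ≡ suc (T (pred i) r′) * suc (T (suc i) (residue p j)))
            (sym (residue-⁺ p j)) (proj₂ (validAt j 1≤i i≤n))
  }
  where
  validAt : ∀ {i} j → 1 ≤ i → i ≤ n → ValidCell p T i (residue p j)
  validAt j 1≤i i≤n with ≤⇒∃suc-toℕ 1≤i i≤n | <⇒∃toℕ (residue<p p j)
  ... | i′ , refl | r , r≡residue = subst (ValidCell p T (suc (toℕ i′))) r≡residue (valid i′ r)

-- Realising the listed tuples

at : List ℕ → ℕ → ℕ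
at []       _       = 0
at (x ∷ _)  zero    = x
at (_ ∷ xs) (suc r) = at xs r

-- Columns 0–6 of rows 1–4, filled from the fundamental domain by the glide y[i,j] = y[5-i,j+i+1].
glideRow : ℕ → Vec ℕ 14 → List ℕ
glideRow 1 (a ∷ b ∷ c ∷ d ∷ e ∷ f ∷ g ∷ h ∷ i ∷ j ∷ k ∷ l ∷ m ∷ n ∷ []) = a ∷ e ∷ i ∷ l ∷ n ∷ d ∷ h ∷ []
glideRow 2 (a ∷ b ∷ c ∷ d ∷ e ∷ f ∷ g ∷ h ∷ i ∷ j ∷ k ∷ l ∷ m ∷ n ∷ []) = b ∷ f ∷ j ∷ m ∷ c ∷ g ∷ k ∷ []
glideRow 3 (a ∷ b ∷ c ∷ d ∷ e ∷ f ∷ g ∷ h ∷ i ∷ j ∷ k ∷ l ∷ m ∷ n ∷ []) = c ∷ g ∷ k ∷ b ∷ f ∷ j ∷ m ∷ []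
glideRow 4 (a ∷ b ∷ c ∷ d ∷ e ∷ f ∷ g ∷ h ∷ i ∷ j ∷ k ∷ l ∷ m ∷ n ∷ []) = d ∷ h ∷ a ∷ e ∷ i ∷ l ∷ n ∷ []
glideRow _ _ = []

glideTable : Vec ℕ 14 → ℕ → ℕ → ℕ
glideTable v i r = at (glideRow i v) r

glideTable-fundamentalDomain : ∀ v → fundamentalDomain (periodic 7 (glideTable v)) ≡ v
glideTable-fundamentalDomain (a ∷ b ∷ c ∷ d ∷ e ∷ f ∷ g ∷ h ∷ i ∷ j ∷ k ∷ l ∷ m ∷ n ∷ []) = refl

GlideValid : Vec ℕ 14 → Set
GlideValid v = ∀ (i : Fin 4) (r : Fin 7) → ValidCell 7 (glideTable v) (suc (toℕ i)) (toℕ r)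

listed-glideValid : All.All GlideValid list42
listed-glideValid = toWitness {a? = All.all? glideValid? list42} _
  where
  glideValid? : ∀ v → Dec (GlideValid v)
  glideValid? v = all? λ i → all? λ r → validCell? 7 (glideTable v) (suc (toℕ i)) (toℕ r)

listed⇒ℕYFrieze : ∀ {v} → v ∈ list42 → Σ (ℕYFrieze 4) (λ N → fundamentalDomain (ℕYFrieze.Y N) ≡ v)
listed⇒ℕYFrieze {v} v∈list42 =
  periodicFrieze (glideTable v) (λ _ → refl) (λ _ → refl) (All.lookup listed-glideValid v∈list42) ,
  glideTable-fundamentalDomain v

tuple14-fromArithmetic : (F : YFrieze 4) (arithmetic : Arithmetic F) →
  tuple14 F ≡ Data.Vec.map ℕtoℚ (fundamentalDomain (entry F arithmetic))
tuple14-fromArithmetic F arithmetic =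
  cong₂ _∷_ (row₁ 0) (cong₂ _∷_ (row₂ 0) (cong₂ _∷_ (row₃ 0) (cong₂ _∷_ (row₄ 0) (
  cong₂ _∷_ (row₁ 1) (cong₂ _∷_ (row₂ 1) (cong₂ _∷_ (row₃ 1) (cong₂ _∷_ (row₄ 1) (
  cong₂ _∷_ (row₁ 2) (cong₂ _∷_ (row₂ 2) (cong₂ _∷_ (row₃ 2) (
  cong₂ _∷_ (row₁ 3) (cong₂ _∷_ (row₂ 3) (
  cong₂ _∷_ (row₁ 4) refl)))))))))))))
  where
  Agrees : ℕ → Set
  Agrees i = ∀ j → y F i (+ j) ≡ ℕtoℚ (entry F arithmetic i (+ j))
  row₁ : Agrees 1
  row₁ j = y≡entry F arithmetic (+ j) (s≤s z≤n)
  row₂ : Agrees 2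
  row₂ j = y≡entry F arithmetic (+ j) (s≤s (s≤s z≤n))
  row₃ : Agrees 3
  row₃ j = y≡entry F arithmetic (+ j) (s≤s (s≤s (s≤s z≤n)))
  row₄ : Agrees 4
  row₄ j = y≡entry F arithmetic (+ j) (s≤s (s≤s (s≤s (s≤s z≤n))))

theorem3p7 : (t : Vec ℚ 14) →
    (Σ (YFrieze 4) (λ F → Arithmetic F × (tuple14 F ≡ t)))
      ⇔ (t ∈ map (Data.Vec.map ℕtoℚ) list42)
theorem3p7 t = mk⇔ realised⇒listed listed⇒realised
  where
  realised⇒listed : Σ (YFrieze 4) (λ F → Arithmetic F × (tuple14 F ≡ t)) → t ∈ map (Data.Vec.map ℕtoℚ) list42
  realised⇒listed (F , arithmetic , refl) =
    subst (_∈ map (Data.Vec.map ℕtoℚ) list42) (sym (tuple14-fromArithmetic F arithmetic))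
      (∈-map⁺ (Data.Vec.map ℕtoℚ) (Width₄.fundamentalDomain∈list42 (fromArithmetic F arithmetic)))

  listed⇒realised : t ∈ map (Data.Vec.map ℕtoℚ) list42 → Σ (YFrieze 4) (λ F → Arithmetic F × (tuple14 F ≡ t))
  listed⇒realised t∈ =
    let v , v∈list42 , t≡v = ∈-map⁻ (Data.Vec.map ℕtoℚ) t∈
        N , domain≡v       = listed⇒ℕYFrieze v∈list42
    in toYFrieze N , toYFrieze-arithmetic N , trans (cong (Data.Vec.map ℕtoℚ) domain≡v) (sym t≡v)
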